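{- Let $R$ be either $\mathbb{F}_q$ ($q$ a prime power) or $\mathbb{Z}_k$ ($k\ge2$), with elements listed in a fixed order $0=\omega_0,\dots,\omega_{|R|-1}$, and let $C,D$ be $R$-linear codes of length $n$. Then \[ \Delta(C,D):=\frac{1}{n!}\sum_{\sigma\in S_n}|C\cap D^\sigma|=\sum_{r}\frac{A_r^CA_r^D}{\binom{n}{r_0,\dots,r_{|R|-1}}}, \] where the sum runs over all compositions $r=(r_0,\dots,r_{|R|-1})$ of $n$ and $\binom{n}{r_0,\dots,r_{|R|-1}}=\frac{n!}{r_0!\cdots r_{|R|-1}!}$.
   Context: An $\mathbb{F}_q$-linear code of length $n$ is a subspace of $\mathbb{F}_q^n$; a $\mathbb{Z}_k$-linear code is an additive subgroup of $\mathbb{Z}_k^n$. A composition of $n$ is a vector of $|R|$ non-negative integers summing to $n$; the composition of $u\in R^n$ is $(s_0(u),\dots,s_{|R|-1}(u))$ with $s_i(u)$ the number of coordinates of $u$ equal to $\omega_i$; $A_r^C$ is the number of codewords of $C$ with composition $r$. For $\sigma\in S_n$, $D^\sigma=\{(v_{\sigma(1)},\dots,v_{\sigma(n)}):v\in D\}$. -}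

module Defs where

open import Data.Nat as ℕ using (ℕ; zero; suc; _<_; _≥_; NonZero)
open import Data.Nat.Properties using (_!≢0)
open import Data.Nat.ListAction using (sum; product)
import Level
open import Data.Nat.DivMod using (_mod_)
open import Data.Fin as Fin using (Fin; toℕ; fromℕ<)
open import Data.Fin.Properties as FinP using ()
open import Data.Vec as Vec using (Vec; []; _∷_; lookup; tabulate; toList)
open import Data.Vec.Properties using (≡-dec)
open import Data.List as List using (List; []; _∷_; length; filter; concatMap; upTo; allFin; foldr)
open import Data.List.Relation.Unary.Any using (Any; any?)
open import Data.List.Relation.Unary.Unique.Propositional using (Unique)
open import Data.List.Relation.Unary.Unique.DecPropositional using (unique?)
open import Data.Integer as ℤ using (+_)
open import Data.Rational as ℚ using (ℚ; _/_; 0ℚ)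
open import Data.Product using (Σ; ∃; ∃-syntax; _×_; _,_; proj₁; proj₂)
open import Data.Sum using (_⊎_)
open import Data.Unit using (⊤)
open import Relation.Nullary using (¬_; Dec; yes; no)
open import Relation.Nullary.Decidable using (_×-dec_)
open import Relation.Unary using (Pred; Decidable)
open import Relation.Binary.PropositionalEquality using (_≡_; _≢_; refl; cong; trans; sym)
open import Relation.Binary.Definitions using (DecidableEquality)
open import Function.Definitions using (Bijective)
open import Algebra.Structures using (IsCommutativeRing)

record FinRing : Set₁ where
  field
    Carrier  : Set
    _+_ _*_  : Carrier → Carrier → Carrier
    -_       : Carrier → Carrier
    0# 1#    : Carrier
    isCommutativeRing : IsCommutativeRing _≡_ _+_ _*_ -_ 0# 1#
    card     : ℕ
    ω        : Fin card → Carrier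
    ω-bij    : Bijective _≡_ _≡_ ω
    ω-zero   : Σ (0 < card) λ p → ω (fromℕ< p) ≡ 0#

IsFiniteField : FinRing → Set
IsFiniteField R = (1# ≢ 0#) × (∀ x → x ≢ 0# → ∃[ y ] (x * y ≡ 1#))
  where open FinRing R

module _ (k : ℕ) .{{_ : NonZero k}} where
  _+ₖ_ : Fin k → Fin k → Fin k
  a +ₖ b = (toℕ a ℕ.+ toℕ b) mod k
  _*ₖ_ : Fin k → Fin k → Fin k
  a *ₖ b = (toℕ a ℕ.* toℕ b) mod k
  1ₖ : Fin k
  1ₖ = 1 mod k

IsZk : FinRing → Set
IsZk R = Σ ℕ λ k′ → let k = suc (suc k′) in
  Σ (Fin k → Carrier) λ φ →
      Bijective _≡_ _≡_ φ
    × (∀ a b → φ (_+ₖ_ k a b) ≡ φ a + φ b)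
    × (∀ a b → φ (_*ₖ_ k a b) ≡ φ a * φ b)
    × (φ (1ₖ k) ≡ 1#)
  where open FinRing R

module _ (R : FinRing) where
  open FinRing R

  ω⁻¹ : Carrier → Fin card
  ω⁻¹ y = proj₁ (proj₂ ω-bij y)

  ω∘ω⁻¹ : ∀ y → ω (ω⁻¹ y) ≡ y
  ω∘ω⁻¹ y = proj₂ (proj₂ ω-bij y) refl

  _≟R_ : DecidableEquality Carrier
  x ≟R y with ω⁻¹ x Fin.≟ ω⁻¹ y
  ... | yes e = yes (trans (sym (ω∘ω⁻¹ x)) (trans (cong ω e) (ω∘ω⁻¹ y)))
  ... | no ne = no λ e → ne (cong ω⁻¹ e)

  record LinearCode (n : ℕ) : Set₁ where
    field
      _∈C   : Pred (Vec Carrier n) Level.zero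
      ∈C?   : Decidable _∈C
      zero∈ : Vec.replicate n 0# ∈C
      +∈    : ∀ {u v} → u ∈C → v ∈C → Vec.zipWith _+_ u v ∈C
      -∈    : ∀ {u} → u ∈C → Vec.map -_ u ∈C
      ·∈    : ∀ a {u} → u ∈C → Vec.map (a *_) u ∈C

  allFinVecs : (m n : ℕ) → List (Vec (Fin m) n)
  allFinVecs m zero    = [] ∷ []
  allFinVecs m (suc n) = concatMap (λ a → List.map (a ∷_) (allFinVecs m n)) (allFin m)

  allVecs : (n : ℕ) → List (Vec Carrier n)
  allVecs n = List.map (Vec.map ω) (allFinVecs card n)

  countVecs : {n : ℕ} {P : Pred (Vec Carrier n) Level.zero} → Decidable P → ℕ
  countVecs {n} P? = length (filter P? (allVecs n))

  composition : {n : ℕ} → Vec Carrier n → Vec ℕ card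
  composition u = tabulate λ i → length (filter (λ x → x ≟R ω i) (toList u))

  A : {n : ℕ} → LinearCode n → Vec ℕ card → ℕ
  A C r = countVecs (λ u → ∈C? u ×-dec ≡-dec ℕ._≟_ (composition u) r)
    where open LinearCode C

  -- S_n : the permutations σ of {1..n}, σ(i) = lookup σ i, each listed once
  -- (maps Fin n → Fin n with pairwise distinct values)
  Sym : (n : ℕ) → List (Vec (Fin n) n)
  Sym n = filter (λ σ → unique? Fin._≟_ (toList σ)) (allFinVecs n n)

  permute : {n : ℕ} → Vec (Fin n) n → Vec Carrier n → Vec Carrier n
  permute σ v = tabulate λ i → lookup v (lookup σ i)

  _∈_^_ : {n : ℕ} → Vec Carrier n → LinearCode n → Vec (Fin n) n → Set
  u ∈ D ^ σ = Any (λ v → (v ∈C) × (u ≡ permute σ v)) (allVecs _)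
    where open LinearCode D

  ∈^? : {n : ℕ} (D : LinearCode n) (σ : Vec (Fin n) n) → Decidable (_∈ D ^ σ)
  ∈^? D σ u = any? (λ v → ∈C? v ×-dec ≡-dec _≟R_ u (permute σ v)) (allVecs _)
    where open LinearCode D

  ∣C∩D^σ∣ : {n : ℕ} → LinearCode n → LinearCode n → Vec (Fin n) n → ℕ
  ∣C∩D^σ∣ C D σ = countVecs (λ u → LinearCode.∈C? C u ×-dec ∈^? D σ u)

  comps : (m n : ℕ) → List (Vec ℕ m)
  comps zero    zero    = [] ∷ []
  comps zero    (suc n) = []
  comps (suc m) n = concatMap (λ k → List.map (k ∷_) (comps m (n ℕ.∸ k))) (upTo (suc n))

  sumℚ : List ℚ → ℚ
  sumℚ = foldr ℚ._+_ 0ℚ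

  sumℕ : List ℕ → ℕ
  sumℕ = sum

  Δ : {n : ℕ} → LinearCode n → LinearCode n → ℚ
  Δ {n} C D = (+ sumℕ (List.map (∣C∩D^σ∣ C D) (Sym n))) / (n ℕ.!)
    where instance _ = n !≢0

  -- multinomial coefficient n!/(r_0!⋯r_{m-1}!), represented by its reciprocal
  -- 1 / binom(n; r) = (r_0!⋯r_{m-1}!) / n!
  inv-multinomial : (n : ℕ) {m : ℕ} → Vec ℕ m → ℚ
  inv-multinomial n r = (+ product (List.map ℕ._! (toList r))) / (n ℕ.!)
    where instance _ = n !≢0

  RHS : {n : ℕ} → LinearCode n → LinearCode n → ℚ
  RHS {n} C D = sumℚ (List.map (λ r → (+ (A C r ℕ.* A D r)) / 1 ℚ.* inv-multinomial n r)
                               (comps card n))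

module Submission where

-- Proof by double counting.  Writing 𝟙 for indicators,
--   Σ_σ |C ∩ D^σ| = Σ_{u ∈ C} Σ_{v ∈ D} #{σ : u = σ v},
-- and the number of permutations carrying the word v to the word u is
-- 𝟙(u, v have the same composition) · s₀(u)! ⋯ s_{|R|-1}(u)!  (transporters-formula,
-- by induction on n, choosing the first value of σ).  Grouping the pairs (u,v)
-- instead by their common composition r gives Σ_r A_r^C A_r^D r₀! ⋯ r_{|R|-1}!;
-- dividing by n! yields the identity.

open import Defs
open import Data.Nat as ℕ using (ℕ; zero; suc; _+_; _*_; _!; NonZero)
open import Data.Nat.Properties
  using (+-identityʳ; +-assoc; +-cancelˡ-≡; *-zeroʳ; *-identityʳ; *-assoc; *-comm;
         *-distribˡ-+; m≤m+n; m+n∸m≡n; _!≢0; +-commutativeSemigroup; *-commutativeSemigroup)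
open import Data.Nat.ListAction using (sum; product)
open import Data.Nat.ListAction.Properties using (sum-↭)
open import Data.Nat.Tactic.RingSolver using (solve-∀)
open import Data.Fin as Fin using (Fin; zero; suc; punchIn; punchOut)
open import Data.Fin.Properties using (punchIn-injective; punchInᵢ≢i; punchIn-punchOut; suc-injective)
open import Data.Vec as Vec using (Vec; []; _∷_; lookup; tabulate; toList; removeAt)
open import Data.Vec.Properties using (∷-injective; lookup-map; toList-map; lookup∘tabulate; tabulate∘lookup; tabulate-∘; tabulate-cong; ≡-dec)
open import Data.List as List using (List; []; _∷_; map; filter; length; concatMap; allFin; upTo; _++_)
open import Data.List.Properties using (map-tabulate; map-cong)
open import Data.List.Relation.Unary.Any as Any using (any?; here; there)
open import Data.List.Relation.Unary.All as All using (All; []; _∷_)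
open import Data.List.Relation.Unary.AllPairs using ([]; _∷_)
open import Data.List.Relation.Unary.Unique.Propositional using (Unique)
import Data.List.Relation.Unary.Unique.Propositional.Properties as Unique
open import Data.List.Relation.Unary.Unique.DecPropositional using (unique?)
open import Data.List.Membership.Propositional using (_∈_; find)
open import Data.List.Membership.Propositional.Properties
  using (∈-map⁺; ∈-map⁻; ∈-concatMap⁺; ∈-concatMap⁻; ∈-allFin; ∈-filter⁺; ∈-filter⁻; ∈-upTo⁺)
open import Data.List.Membership.Propositional.Properties.WithK using (unique∧set⇒bag)
open import Data.List.Relation.Binary.BagAndSetEquality using (∼bag⇒↭)
import Data.List.Relation.Binary.Permutation.Propositional.Properties as Perm
import Data.Integer as ℤ
import Data.Integer.Properties as ℤ
open import Data.Integer.Tactic.RingSolver as ℤ-Solver using ()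
open import Data.Rational as ℚ using (ℚ; _/_; 0ℚ; toℚᵘ; fromℚᵘ)
open import Data.Rational.Properties using (0/n≡0; fromℚᵘ-toℚᵘ; fromℚᵘ-cong; toℚᵘ-fromℚᵘ; toℚᵘ-homo-+; toℚᵘ-homo-*)
open import Data.Rational.Unnormalised as ℚᵘ using (mkℚᵘ; *≡*)
import Data.Rational.Unnormalised.Properties as ℚᵘ
open import Data.Product using (_×_; _,_; ∃; proj₁; proj₂)
open import Data.Sum using (_⊎_)
open import Data.Bool using (if_then_else_)
open import Data.Empty using (⊥-elim)
open import Function using (_∘_; _⇔_; mk⇔; Equivalence)
open import Relation.Nullary using (Dec; yes; no; does; ¬_)
open import Relation.Nullary.Decidable using (_×-dec_)
open import Relation.Unary using (Pred; Decidable)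
open import Relation.Binary.Definitions using (DecidableEquality)
open import Relation.Binary.PropositionalEquality
open import Algebra.Properties.CommutativeSemigroup +-commutativeSemigroup
  using (interchange) renaming (x∙yz≈y∙xz to +-leftComm)
open import Algebra.Properties.CommutativeSemigroup *-commutativeSemigroup
  using () renaming (x∙yz≈y∙xz to *-leftComm)

𝟙 : ∀ {p} {P : Set p} → Dec P → ℕ
𝟙 d = if does d then 1 else 0

𝟙-yes : ∀ {p} {P : Set p} (d : Dec P) → P → 𝟙 d ≡ 1
𝟙-yes (yes _) _  = refl
𝟙-yes (no ¬p) p = ⊥-elim (¬p p)

𝟙-no : ∀ {p} {P : Set p} (d : Dec P) → ¬ P → 𝟙 d ≡ 0
𝟙-no (yes p) ¬p = ⊥-elim (¬p p)
𝟙-no (no _)  _  = refl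

𝟙-× : ∀ {p q} {P : Set p} {Q : Set q} (a : Dec P) (b : Dec Q) → 𝟙 (a ×-dec b) ≡ 𝟙 a * 𝟙 b
𝟙-× (yes _) (yes _) = refl
𝟙-× (yes _) (no _)  = refl
𝟙-× (no _)  _       = refl

𝟙-⇔ : ∀ {p q} {P : Set p} {Q : Set q} → P ⇔ Q → (a : Dec P) (b : Dec Q) → 𝟙 a ≡ 𝟙 b
𝟙-⇔ P⇔Q (yes _) (yes _) = refl
𝟙-⇔ P⇔Q (no _)  (no _)  = refl
𝟙-⇔ P⇔Q (yes p) (no ¬q) = ⊥-elim (¬q (Equivalence.to P⇔Q p))
𝟙-⇔ P⇔Q (no ¬p) (yes q) = ⊥-elim (¬p (Equivalence.from P⇔Q q))

𝟙-sym : ∀ {a} {A : Set a} {x y : A} (p : Dec (x ≡ y)) (q : Dec (y ≡ x)) → 𝟙 p ≡ 𝟙 q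
𝟙-sym = 𝟙-⇔ (mk⇔ sym sym)

Σ : ∀ {a} {A : Set a} → List A → (A → ℕ) → ℕ
Σ xs f = sum (map f xs)

module _ {a} {A : Set a} where

  Σ-cong-∈ : ∀ xs {f g : A → ℕ} → (∀ {x} → x ∈ xs → f x ≡ g x) → Σ xs f ≡ Σ xs g
  Σ-cong-∈ []       e = refl
  Σ-cong-∈ (x ∷ xs) e = cong₂ _+_ (e (here refl)) (Σ-cong-∈ xs (e ∘ there))

  Σ-cong : ∀ xs {f g : A → ℕ} → (∀ x → f x ≡ g x) → Σ xs f ≡ Σ xs g
  Σ-cong xs e = Σ-cong-∈ xs (λ {x} _ → e x)

  Σ-zero : ∀ xs {f : A → ℕ} → (∀ {x} → x ∈ xs → f x ≡ 0) → Σ xs f ≡ 0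
  Σ-zero []       e = refl
  Σ-zero (x ∷ xs) e = cong₂ _+_ (e (here refl)) (Σ-zero xs (e ∘ there))

  Σ-++ : ∀ xs ys (f : A → ℕ) → Σ (xs ++ ys) f ≡ Σ xs f + Σ ys f
  Σ-++ []       ys f = refl
  Σ-++ (x ∷ xs) ys f = trans (cong (f x +_) (Σ-++ xs ys f)) (sym (+-assoc (f x) _ _))

  Σ-+ : ∀ xs (f g : A → ℕ) → Σ xs (λ x → f x + g x) ≡ Σ xs f + Σ xs g
  Σ-+ []       f g = refl
  Σ-+ (x ∷ xs) f g = trans (cong (f x + g x +_) (Σ-+ xs f g)) (interchange (f x) (g x) (Σ xs f) (Σ xs g))

  Σ-*ˡ : ∀ xs c (f : A → ℕ) → Σ xs (λ x → c * f x) ≡ c * Σ xs f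
  Σ-*ˡ []       c f = sym (*-zeroʳ c)
  Σ-*ˡ (x ∷ xs) c f = trans (cong (c * f x +_) (Σ-*ˡ xs c f)) (sym (*-distribˡ-+ c (f x) _))

  Σ-*ʳ : ∀ xs c (f : A → ℕ) → Σ xs (λ x → f x * c) ≡ Σ xs f * c
  Σ-*ʳ xs c f = trans (Σ-cong xs (λ x → *-comm (f x) c)) (trans (Σ-*ˡ xs c f) (*-comm c _))

  length-filter : ∀ {p} {P : Pred A p} (P? : Decidable P) xs →
                  length (filter P? xs) ≡ Σ xs (𝟙 ∘ P?)
  length-filter P? []       = refl
  length-filter P? (x ∷ xs) with P? x
  ... | yes _ = cong suc (length-filter P? xs)
  ... | no _  = length-filter P? xs

  𝟙-any : ∀ {p} {P : Pred A p} (P? : Decidable P) xs → Unique xs →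
          (∀ {y z} → P y → P z → y ≡ z) → 𝟙 (any? P? xs) ≡ Σ xs (𝟙 ∘ P?)
  𝟙-any P? []       _          _   = refl
  𝟙-any P? (x ∷ xs) (x∉ ∷ uxs) one with P? x
  ... | no _  = 𝟙-any P? xs uxs one
  ... | yes px = sym (cong suc (Σ-zero xs λ {y} y∈ →
                   𝟙-no (P? y) (λ py → All.lookup x∉ y∈ (one px py))))

  Σ-δ : (_≟_ : DecidableEquality A) {x : A} (ys : List A) (g : A → ℕ) →
        Unique ys → x ∈ ys → Σ ys (λ y → 𝟙 (x ≟ y) * g y) ≡ g x
  Σ-δ _≟_ (y ∷ ys) g (y∉ ∷ _) (here refl) = begin
      𝟙 (y ≟ y) * g y + Σ ys (λ z → 𝟙 (y ≟ z) * g z)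
    ≡⟨ cong₂ _+_ (cong (_* g y) (𝟙-yes (y ≟ y) refl))
                 (Σ-zero ys (λ z∈ → cong (_* _) (𝟙-no (y ≟ _) (λ { refl → All.lookup y∉ z∈ refl })))) ⟩
      1 * g y + 0
    ≡⟨ trans (+-identityʳ _) (+-identityʳ _) ⟩
      g y ∎
    where open ≡-Reasoning
  Σ-δ _≟_ {x} (y ∷ ys) g (y∉ ∷ uys) (there x∈) =
    cong₂ _+_ (cong (_* g y) (𝟙-no (x ≟ y) (λ { refl → All.lookup y∉ x∈ refl })))
              (Σ-δ _≟_ ys g uys x∈)

  Σ-sameElements : ∀ xs ys (f : A → ℕ) → Unique xs → Unique ys →
                   (∀ {x} → x ∈ xs ⇔ x ∈ ys) → Σ xs f ≡ Σ ys f
  Σ-sameElements xs ys f uxs uys same =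
    sum-↭ (Perm.map⁺ f (∼bag⇒↭ (unique∧set⇒bag uxs uys same)))

module _ {a b} {A : Set a} {B : Set b} where

  Σ-map : ∀ (h : A → B) xs (f : B → ℕ) → Σ (map h xs) f ≡ Σ xs (f ∘ h)
  Σ-map h []       f = refl
  Σ-map h (x ∷ xs) f = cong (f (h x) +_) (Σ-map h xs f)

  Σ-concatMap : ∀ (g : A → List B) xs (f : B → ℕ) → Σ (concatMap g xs) f ≡ Σ xs (λ x → Σ (g x) f)
  Σ-concatMap g []       f = refl
  Σ-concatMap g (x ∷ xs) f = trans (Σ-++ (g x) (concatMap g xs) f) (cong (Σ (g x) f +_) (Σ-concatMap g xs f))

  Σ-swap : ∀ xs ys (f : A → B → ℕ) → Σ xs (λ x → Σ ys (f x)) ≡ Σ ys (λ y → Σ xs (λ x → f x y))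
  Σ-swap []       ys f = sym (Σ-zero ys (λ _ → refl))
  Σ-swap (x ∷ xs) ys f = trans (cong (Σ ys (f x) +_) (Σ-swap xs ys f)) (sym (Σ-+ ys (f x) _))

  Σ-product : ∀ xs ys (f : A → ℕ) (g : B → ℕ) c →
              Σ xs f * Σ ys g * c ≡ Σ xs (λ x → Σ ys (λ y → f x * (g y * c)))
  Σ-product xs ys f g c = begin
      Σ xs f * Σ ys g * c                      ≡⟨ *-assoc (Σ xs f) (Σ ys g) c ⟩
      Σ xs f * (Σ ys g * c)                    ≡⟨ Σ-*ʳ xs (Σ ys g * c) f ⟨
      Σ xs (λ x → f x * (Σ ys g * c))          ≡⟨ Σ-cong xs (λ x → cong (f x *_) (Σ-*ʳ ys c g)) ⟨
      Σ xs (λ x → f x * Σ ys (λ y → g y * c))  ≡⟨ Σ-cong xs (λ x → Σ-*ˡ ys (f x) _) ⟨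
      Σ xs (λ x → Σ ys (λ y → f x * (g y * c))) ∎
    where open ≡-Reasoning

Σ-rotate : ∀ {a b c} {A : Set a} {B : Set b} {C : Set c} zs xs ys (f : C → A → B → ℕ) →
           Σ zs (λ z → Σ xs (λ x → Σ ys (f z x))) ≡ Σ xs (λ x → Σ ys (λ y → Σ zs (λ z → f z x y)))
Σ-rotate zs xs ys f = trans (Σ-swap zs xs _) (Σ-cong xs (λ x → Σ-swap zs ys (λ z → f z x)))

comprehension : ∀ {a b c} {A : Set a} {B : Set b} {C : Set c} →
                (A → B → C) → List A → (A → List B) → List C
comprehension g xs ys = concatMap (λ x → map (g x) (ys x)) xs

module _ {a b c} {A : Set a} {B : Set b} {C : Set c} (g : A → B → C) where

  ∈-comprehension⁺ : ∀ {xs ys x y} → x ∈ xs → y ∈ ys x → g x y ∈ comprehension g xs ys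
  ∈-comprehension⁺ {ys = ys} x∈ y∈ = ∈-concatMap⁺ (λ x → map (g x) (ys x)) (Any.map (λ { refl → ∈-map⁺ (g _) y∈ }) x∈)

  ∈-comprehension⁻ : ∀ xs ys {z} → z ∈ comprehension g xs ys →
                     ∃ λ x → ∃ λ y → x ∈ xs × y ∈ ys x × z ≡ g x y
  ∈-comprehension⁻ xs ys z∈ with find (∈-concatMap⁻ (λ x → map (g x) (ys x)) {xs = xs} z∈)
  ... | x , x∈ , z∈′ with ∈-map⁻ (g x) z∈′
  ... | y , y∈ , z≡ = x , y , x∈ , y∈ , z≡

  comprehension-unique : (∀ {x x′ y y′} → g x y ≡ g x′ y′ → x ≡ x′ × y ≡ y′) →
                         ∀ xs ys → Unique xs → (∀ x → Unique (ys x)) → Unique (comprehension g xs ys)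
  comprehension-unique inj []       ys _          _   = []
  comprehension-unique inj (x ∷ xs) ys (x∉ ∷ uxs) uys =
    Unique.++⁺ (Unique.map⁺ (proj₂ ∘ inj) (uys x)) (comprehension-unique inj xs ys uxs uys) disjoint
    where
    disjoint : ∀ {z} → ¬ (z ∈ map (g x) (ys x) × z ∈ comprehension g xs ys)
    disjoint (z∈ , z∈′) with ∈-map⁻ (g x) z∈ | ∈-comprehension⁻ xs ys z∈′
    ... | _ , _ , refl | _ , _ , x′∈ , _ , e = All.lookup x∉ x′∈ (proj₁ (inj e))

  Σ-comprehension : ∀ xs ys (f : C → ℕ) → Σ (comprehension g xs ys) f ≡ Σ xs (λ x → Σ (ys x) (f ∘ g x))
  Σ-comprehension xs ys f =
    trans (Σ-concatMap (λ x → map (g x) (ys x)) xs f) (Σ-cong xs (λ x → Σ-map (g x) (ys x) f))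

Vec-map-injective : ∀ {a b} {A : Set a} {B : Set b} {f : A → B} → (∀ {x y} → f x ≡ f y → x ≡ y) →
                    ∀ {n} {v w : Vec A n} → Vec.map f v ≡ Vec.map f w → v ≡ w
Vec-map-injective inj {v = []}    {[]}    e = refl
Vec-map-injective inj {v = x ∷ v} {y ∷ w} e with ∷-injective e
... | fx≡fy , e′ = cong₂ _∷_ (inj fx≡fy) (Vec-map-injective inj e′)

Vec-ext : ∀ {a} {A : Set a} {n} {v w : Vec A n} → (∀ i → lookup v i ≡ lookup w i) → v ≡ w
Vec-ext {v = v} {w} e = trans (sym (tabulate∘lookup v)) (trans (tabulate-cong e) (tabulate∘lookup w))

toList∘tabulate : ∀ {a} {A : Set a} {m} (f : Fin m → A) → toList (tabulate f) ≡ List.tabulate f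
toList∘tabulate {m = zero}  f = refl
toList∘tabulate {m = suc m} f = cong (f zero ∷_) (toList∘tabulate (f ∘ suc))

sum-tabulate : ∀ {m} (f : Fin m → ℕ) → sum (toList (tabulate f)) ≡ Σ (allFin m) f
sum-tabulate f = trans (cong sum (toList∘tabulate f)) (sym (cong sum (map-tabulate (λ i → i) f)))

Σ-removeAt : ∀ {a} {A : Set a} {n} (v : Vec A (suc n)) j (f : A → ℕ) →
             Σ (toList v) f ≡ f (lookup v j) + Σ (toList (removeAt v j)) f
Σ-removeAt (x ∷ v)     zero    f = refl
Σ-removeAt (x ∷ y ∷ v) (suc j) f =
  trans (cong (f x +_) (Σ-removeAt (y ∷ v) j f)) (+-leftComm (f x) (f (lookup (y ∷ v) j)) _)

Σ-lookup : ∀ {a} {A : Set a} {n} (v : Vec A n) (h : A → ℕ) → Σ (allFin n) (h ∘ lookup v) ≡ Σ (toList v) h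
Σ-lookup v h = begin
    Σ (allFin _) (h ∘ lookup v)            ≡⟨ sum-tabulate (h ∘ lookup v) ⟨
    sum (toList (tabulate (h ∘ lookup v)))  ≡⟨ cong (sum ∘ toList) (trans (tabulate-∘ h (lookup v)) (cong (Vec.map h) (tabulate∘lookup v))) ⟩
    sum (toList (Vec.map h v))              ≡⟨ cong sum (toList-map h v) ⟩
    Σ (toList v) h                          ∎
  where open ≡-Reasoning

lookup-removeAt : ∀ {a} {A : Set a} {n} (v : Vec A (suc n)) j i →
                  lookup (removeAt v j) i ≡ lookup v (punchIn j i)
lookup-removeAt (x ∷ v)     zero    i       = refl
lookup-removeAt (x ∷ y ∷ v) (suc j) zero    = refl
lookup-removeAt (x ∷ y ∷ v) (suc j) (suc i) = lookup-removeAt (y ∷ v) j i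

module _ (R : FinRing) where

  allFinVecs-unique : ∀ m n → Unique (allFinVecs R m n)
  allFinVecs-unique m zero    = [] ∷ []
  allFinVecs-unique m (suc n) =
    comprehension-unique _∷_ ∷-injective (allFin m) _ (Unique.allFin⁺ m) (λ _ → allFinVecs-unique m n)

  allFinVecs-complete : ∀ m n (v : Vec (Fin m) n) → v ∈ allFinVecs R m n
  allFinVecs-complete m zero    []      = here refl
  allFinVecs-complete m (suc n) (a ∷ v) = ∈-comprehension⁺ _∷_ (∈-allFin a) (allFinVecs-complete m n v)

  allVecs-unique : ∀ n → Unique (allVecs R n)
  allVecs-unique n = Unique.map⁺ (Vec-map-injective (proj₁ (FinRing.ω-bij R))) (allFinVecs-unique (FinRing.card R) n)

-- A permutation of n+1 letters is determined by its first value j and by a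
-- permutation τ of n letters, whose values are shifted past j.
insert : ∀ {n} → Fin (suc n) → Vec (Fin n) n → Vec (Fin (suc n)) (suc n)
insert j τ = j ∷ Vec.map (punchIn j) τ

insert-injective : ∀ {n} {j j′ : Fin (suc n)} {τ τ′} → insert j τ ≡ insert j′ τ′ → j ≡ j′ × τ ≡ τ′
insert-injective {j = j} e with ∷-injective e
... | refl , e′ = refl , Vec-map-injective (punchIn-injective j _ _) e′

perms : (n : ℕ) → List (Vec (Fin n) n)
perms zero    = [] ∷ []
perms (suc n) = comprehension insert (allFin (suc n)) (λ _ → perms n)

perms-unique : ∀ n → Unique (perms n)
perms-unique zero    = [] ∷ []
perms-unique (suc n) =
  comprehension-unique insert insert-injective (allFin (suc n)) _ (Unique.allFin⁺ (suc n)) (λ _ → perms-unique n)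

perms-injective : ∀ n {σ} → σ ∈ perms n → Unique (toList σ)
perms-injective zero    (here refl) = []
perms-injective (suc n) σ∈ with ∈-comprehension⁻ insert (allFin (suc n)) (λ _ → perms n) σ∈
... | j , τ , _ , τ∈ , refl rewrite toList-map (punchIn j) τ =
  All.tabulate j∉ ∷ Unique.map⁺ (punchIn-injective j _ _) (perms-injective n τ∈)
  where
  j∉ : ∀ {x} → x ∈ List.map (punchIn j) (toList τ) → j ≢ x
  j∉ x∈ with ∈-map⁻ (punchIn j) x∈
  ... | y , _ , refl = punchInᵢ≢i j y ∘ sym

perms-surjective : ∀ n {σ} → σ ∈ perms n → ∀ i → ∃ λ k → lookup σ k ≡ i
perms-surjective (suc n) σ∈ i with ∈-comprehension⁻ insert (allFin (suc n)) (λ _ → perms n) σ∈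
... | j , τ , _ , τ∈ , refl with j Fin.≟ i
...   | yes refl = zero , refl
...   | no j≢i with perms-surjective n τ∈ (punchOut j≢i)
...     | k , e = suc k , trans (lookup-map k (punchIn j) τ) (trans (cong (punchIn j) e) (punchIn-punchOut j≢i))

injective→perms : ∀ n (σ : Vec (Fin n) n) → Unique (toList σ) → σ ∈ perms n
injective→perms zero    []      _          = here refl
injective→perms (suc n) (j ∷ σ) (j∉ ∷ uσ) =
  subst (_∈ perms (suc n)) (cong (j ∷_) (punchIn∘punchOut σ j∉))
        (∈-comprehension⁺ insert (∈-allFin j) (injective→perms n τ uτ))
  where
  punchOuts : ∀ {m} (v : Vec (Fin (suc n)) m) → All (j ≢_) (toList v) → Vec (Fin n) m
  punchOuts []      _          = []
  punchOuts (x ∷ v) (j≢x ∷ ps) = punchOut j≢x ∷ punchOuts v ps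
  punchIn∘punchOut : ∀ {m} (v : Vec (Fin (suc n)) m) ps → Vec.map (punchIn j) (punchOuts v ps) ≡ v
  punchIn∘punchOut []      _          = refl
  punchIn∘punchOut (x ∷ v) (j≢x ∷ ps) = cong₂ _∷_ (punchIn-punchOut j≢x) (punchIn∘punchOut v ps)
  τ = punchOuts σ j∉
  uτ : Unique (toList τ)
  uτ = Unique.map⁻ (subst Unique (trans (cong toList (sym (punchIn∘punchOut σ j∉))) (toList-map (punchIn j) τ)) uσ)

Σ-Sym : (R : FinRing) (n : ℕ) (f : Vec (Fin n) n → ℕ) → Σ (Sym R n) f ≡ Σ (perms n) f
Σ-Sym R n f = Σ-sameElements (Sym R n) (perms n) f
  (Unique.filter⁺ injective? (allFinVecs-unique R n n)) (perms-unique n)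
  (mk⇔ (λ σ∈ → injective→perms n _ (proj₂ (∈-filter⁻ injective? {xs = allFinVecs R n n} σ∈)))
       (λ σ∈ → ∈-filter⁺ injective? (allFinVecs-complete R n n _) (perms-injective n σ∈)))
  where
  injective? = λ (σ : Vec (Fin n) n) → unique? Fin._≟_ (toList σ)

-- r₀! ⋯ r_{m-1}!, the numerator of 1 / binom(n; r) in the statement.
factorials : ∀ {m} → Vec ℕ m → ℕ
factorials r = product (map _! (toList r))

factorials-zeros : ∀ m → factorials (tabulate {n = m} (λ _ → 0)) ≡ 1
factorials-zeros zero    = refl
factorials-zeros (suc m) = trans (+-identityʳ _) (factorials-zeros m)

factorials-bump : ∀ {m} (g h : Fin m → ℕ) i₀ → (∀ i → i ≢ i₀ → h i ≡ g i) → h i₀ ≡ suc (g i₀) →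
                  factorials (tabulate h) ≡ suc (g i₀) * factorials (tabulate g)
factorials-bump g h zero agree bump = begin
    h zero ! * F (h ∘ suc)
  ≡⟨ cong₂ (λ x y → x ! * y) bump (cong factorials (tabulate-cong (λ i → agree (suc i) (λ ())))) ⟩
    suc (g zero) ! * F (g ∘ suc)
  ≡⟨ *-assoc (suc (g zero)) (g zero !) _ ⟩
    suc (g zero) * (g zero ! * F (g ∘ suc)) ∎
  where
  open ≡-Reasoning
  F = λ {m} (f : Fin m → ℕ) → factorials (tabulate f)
factorials-bump g h (suc i₀) agree bump = begin
    h zero ! * F (h ∘ suc)
  ≡⟨ cong₂ (λ x y → x ! * y) (agree zero (λ ()))
           (factorials-bump (g ∘ suc) (h ∘ suc) i₀ (λ i i≢i₀ → agree (suc i) (i≢i₀ ∘ suc-injective)) bump) ⟩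
    g zero ! * (suc (g (suc i₀)) * F (g ∘ suc))
  ≡⟨ *-leftComm (g zero !) (suc (g (suc i₀))) _ ⟩
    suc (g (suc i₀)) * (g zero ! * F (g ∘ suc)) ∎
  where
  open ≡-Reasoning
  F = λ {m} (f : Fin m → ℕ) → factorials (tabulate f)

module _ (R : FinRing) where
  open FinRing R using (Carrier; ω; ω-bij; card)

  private
    _≟_ = _≟R_ R

  ω⁻¹∘ω : ∀ i → ω⁻¹ R (ω i) ≡ i
  ω⁻¹∘ω i = proj₁ ω-bij (ω∘ω⁻¹ R (ω i))

  count : ∀ {n} → Carrier → Vec Carrier n → ℕ
  count b u = Σ (toList u) (λ x → 𝟙 (x ≟ b))

  composition-count : ∀ {n} (u : Vec Carrier n) → composition R u ≡ tabulate (λ i → count (ω i) u)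
  composition-count u = tabulate-cong (λ i → length-filter (λ x → x ≟ ω i) (toList u))

  same-composition⇒same-counts : ∀ {n} {u v : Vec Carrier n} →
                                 composition R u ≡ composition R v → ∀ b → count b u ≡ count b v
  same-composition⇒same-counts {u = u} {v} c b =
    subst (λ b → count b u ≡ count b v) (ω∘ω⁻¹ R b) (count-ω (ω⁻¹ R b))
    where
    count-ω : ∀ i → count (ω i) u ≡ count (ω i) v
    count-ω i = begin
        count (ω i) u                                ≡⟨ lookup∘tabulate _ i ⟨
        lookup (tabulate (λ i → count (ω i) u)) i    ≡⟨ cong (λ w → lookup w i) (trans (sym (composition-count u))
                                                                           (trans c (composition-count v))) ⟩
        lookup (tabulate (λ i → count (ω i) v)) i    ≡⟨ lookup∘tabulate _ i ⟩
        count (ω i) v                                ∎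
      where open ≡-Reasoning

  same-counts⇒same-composition : ∀ {n} {u v : Vec Carrier n} →
                                 (∀ b → count b u ≡ count b v) → composition R u ≡ composition R v
  same-counts⇒same-composition {u = u} {v} e =
    trans (composition-count u) (trans (tabulate-cong (e ∘ ω)) (sym (composition-count v)))

  composition-removeAt : ∀ {n} a (u : Vec Carrier n) v j → lookup v j ≡ a →
                         (composition R u ≡ composition R (removeAt v j)) ⇔ (composition R (a ∷ u) ≡ composition R v)
  composition-removeAt a u v j vⱼ≡a = mk⇔
    (λ c → same-counts⇒same-composition {u = a ∷ u} {v} λ b →
       trans (cong (𝟙 (a ≟ b) +_) (same-composition⇒same-counts {u = u} {removeAt v j} c b)) (sym (split b)))
    (λ c → same-counts⇒same-composition {u = u} {removeAt v j} λ b →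
       +-cancelˡ-≡ (𝟙 (a ≟ b)) _ _ (trans (same-composition⇒same-counts {u = a ∷ u} {v} c b) (split b)))
    where
    split : ∀ b → count b v ≡ 𝟙 (a ≟ b) + count b (removeAt v j)
    split b = trans (Σ-removeAt v j (λ x → 𝟙 (x ≟ b))) (cong (λ x → 𝟙 (x ≟ b) + count b (removeAt v j)) vⱼ≡a)

  Σ-𝟙-ω : ∀ x → Σ (allFin card) (λ i → 𝟙 (x ≟ ω i)) ≡ 1
  Σ-𝟙-ω x = begin
      Σ (allFin card) (λ i → 𝟙 (x ≟ ω i))
    ≡⟨ Σ-cong (allFin card) (λ i → trans (𝟙-⇔ ω-index (x ≟ ω i) (ω⁻¹ R x Fin.≟ i)) (sym (*-identityʳ _))) ⟩
      Σ (allFin card) (λ i → 𝟙 (ω⁻¹ R x Fin.≟ i) * 1)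
    ≡⟨ Σ-δ Fin._≟_ (allFin card) (λ _ → 1) (Unique.allFin⁺ card) (∈-allFin (ω⁻¹ R x)) ⟩
      1 ∎
    where
    open ≡-Reasoning
    ω-index : ∀ {i} → (x ≡ ω i) ⇔ (ω⁻¹ R x ≡ i)
    ω-index {i} = mk⇔ (λ e → trans (cong (ω⁻¹ R) e) (ω⁻¹∘ω i)) (λ e → trans (sym (ω∘ω⁻¹ R x)) (cong ω e))

  composition-sum : ∀ {n} (u : Vec Carrier n) → sum (toList (composition R u)) ≡ n
  composition-sum {n} u = begin
      sum (toList (composition R u))                 ≡⟨ cong (sum ∘ toList) (composition-count u) ⟩
      sum (toList (tabulate (λ i → count (ω i) u)))  ≡⟨ sum-tabulate (λ i → count (ω i) u) ⟩
      Σ (allFin card) (λ i → count (ω i) u)          ≡⟨ Σ-counts u ⟩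
      n                                              ∎
    where
    open ≡-Reasoning
    Σ-counts : ∀ {n} (u : Vec Carrier n) → Σ (allFin card) (λ i → count (ω i) u) ≡ n
    Σ-counts []      = Σ-zero (allFin card) (λ _ → refl)
    Σ-counts (a ∷ u) = trans (Σ-+ (allFin card) _ _) (cong₂ _+_ (Σ-𝟙-ω a) (Σ-counts u))

  comps-unique : ∀ m n → Unique (comps R m n)
  comps-unique zero    zero    = [] ∷ []
  comps-unique zero    (suc n) = []
  comps-unique (suc m) n =
    comprehension-unique _∷_ ∷-injective (upTo (suc n)) _ (Unique.upTo⁺ (suc n)) (λ k → comps-unique m (n ℕ.∸ k))

  comps-complete : ∀ m n (r : Vec ℕ m) → sum (toList r) ≡ n → r ∈ comps R m n
  comps-complete zero    zero []      _    = here refl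
  comps-complete (suc m) n  (k ∷ r) refl =
    ∈-comprehension⁺ _∷_ (∈-upTo⁺ (ℕ.s≤s (m≤m+n k _))) (comps-complete m _ r (sym (m+n∸m≡n k _)))

  composition∈comps : ∀ {n} (u : Vec Carrier n) → composition R u ∈ comps R card n
  composition∈comps u = comps-complete card _ (composition R u) (composition-sum u)

  -- s₀(u)! ⋯ s_{|R|-1}(u)!: the number of permutations fixing the word u.
  stab : ∀ {n} → Vec Carrier n → ℕ
  stab u = factorials (composition R u)

  stab-[] : stab [] ≡ 1
  stab-[] = factorials-zeros card

  stab-∷ : ∀ {n} a (u : Vec Carrier n) → stab (a ∷ u) ≡ suc (count a u) * stab u
  stab-∷ a u = begin
      stab (a ∷ u)
    ≡⟨ cong factorials (composition-count (a ∷ u)) ⟩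
      factorials (tabulate (λ i → 𝟙 (a ≟ ω i) + count (ω i) u))
    ≡⟨ factorials-bump (λ i → count (ω i) u) _ (ω⁻¹ R a) other same ⟩
      suc (count (ω (ω⁻¹ R a)) u) * factorials (tabulate (λ i → count (ω i) u))
    ≡⟨ cong₂ (λ b f → suc (count b u) * f) (ω∘ω⁻¹ R a) (cong factorials (sym (composition-count u))) ⟩
      suc (count a u) * stab u ∎
    where
    open ≡-Reasoning
    other : ∀ i → i ≢ ω⁻¹ R a → 𝟙 (a ≟ ω i) + count (ω i) u ≡ count (ω i) u
    other i i≢ = cong (_+ count (ω i) u) (𝟙-no (a ≟ ω i) (λ e → i≢ (trans (sym (ω⁻¹∘ω i)) (cong (ω⁻¹ R) (sym e)))))
    same : 𝟙 (a ≟ ω (ω⁻¹ R a)) + count (ω (ω⁻¹ R a)) u ≡ suc (count (ω (ω⁻¹ R a)) u)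
    same = cong (_+ count (ω (ω⁻¹ R a)) u) (𝟙-yes (a ≟ ω (ω⁻¹ R a)) (sym (ω∘ω⁻¹ R a)))

-- Counting the permutations that carry one word over R to another.
module _ (R : FinRing) where
  open FinRing R using (Carrier)

  private
    _≟_ = _≟R_ R
    _≟ʷ_ : ∀ {n} → DecidableEquality (Vec Carrier n)
    _≟ʷ_ = ≡-dec _≟_
    _≟ᶜ_ : ∀ {m} → DecidableEquality (Vec ℕ m)
    _≟ᶜ_ = ≡-dec ℕ._≟_

  𝟙-∷ : ∀ {n} a b (u w : Vec Carrier n) → 𝟙 ((a ∷ u) ≟ʷ (b ∷ w)) ≡ 𝟙 (a ≟ b) * 𝟙 (u ≟ʷ w)
  𝟙-∷ a b u w with a ≟ b | u ≟ʷ w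
  ... | yes _ | yes _ = refl
  ... | yes _ | no _  = refl
  ... | no _  | _     = refl

  permute-insert : ∀ {n} j (τ : Vec (Fin n) n) (v : Vec Carrier (suc n)) →
                   permute R (insert j τ) v ≡ lookup v j ∷ permute R τ (removeAt v j)
  permute-insert j τ v = cong (lookup v j ∷_) (tabulate-cong λ i →
    trans (cong (lookup v) (lookup-map i (punchIn j) τ)) (sym (lookup-removeAt v j (lookup τ i))))

  -- Permuting by a listed permutation is injective, since it is surjective on positions.
  permute-injective : ∀ {n} {σ : Vec (Fin n) n} {v w : Vec Carrier n} → σ ∈ perms n →
                      permute R σ v ≡ permute R σ w → v ≡ w
  permute-injective {n} {σ} {v} {w} σ∈ e = Vec-ext λ i → entry i (perms-surjective n σ∈ i)
    where
    entry : ∀ i → ∃ (λ k → lookup σ k ≡ i) → lookup v i ≡ lookup w i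
    entry i (k , refl) = trans (sym (lookup∘tabulate _ k)) (trans (cong (λ t → lookup t k) e) (lookup∘tabulate _ k))

  transporters : ∀ {n} → Vec Carrier n → Vec Carrier n → ℕ
  transporters {n} u v = Σ (perms n) (λ σ → 𝟙 (u ≟ʷ permute R σ v))

  transporters-∷ : ∀ {n} a (u : Vec Carrier n) v →
                   transporters (a ∷ u) v ≡ Σ (allFin (suc n)) (λ j → 𝟙 (a ≟ lookup v j) * transporters u (removeAt v j))
  transporters-∷ {n} a u v =
    trans (Σ-comprehension insert (allFin (suc n)) (λ _ → perms n) _)
          (Σ-cong (allFin (suc n)) λ j → begin
              Σ (perms n) (λ τ → 𝟙 ((a ∷ u) ≟ʷ permute R (insert j τ) v))
            ≡⟨ Σ-cong (perms n) (λ τ → trans (cong (λ w → 𝟙 ((a ∷ u) ≟ʷ w)) (permute-insert j τ v))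
                                             (𝟙-∷ a (lookup v j) u _)) ⟩
              Σ (perms n) (λ τ → 𝟙 (a ≟ lookup v j) * 𝟙 (u ≟ʷ permute R τ (removeAt v j)))
            ≡⟨ Σ-*ˡ (perms n) (𝟙 (a ≟ lookup v j)) _ ⟩
              𝟙 (a ≟ lookup v j) * transporters u (removeAt v j) ∎)
    where open ≡-Reasoning

  transporters-formula : ∀ {n} (u v : Vec Carrier n) →
                         transporters u v ≡ 𝟙 (composition R u ≟ᶜ composition R v) * stab R u
  transporters-formula []      [] = sym (cong₂ _*_ (𝟙-yes (composition R [] ≟ᶜ composition R []) refl) (stab-[] R))
  transporters-formula (a ∷ u) v = begin
      transporters (a ∷ u) v
    ≡⟨ transporters-∷ a u v ⟩
      Σ (allFin _) (λ j → 𝟙 (a ≟ lookup v j) * transporters u (removeAt v j))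
    ≡⟨ Σ-cong (allFin _) (λ j → cong (𝟙 (a ≟ lookup v j) *_) (transporters-formula u (removeAt v j))) ⟩
      Σ (allFin _) (λ j → 𝟙 (a ≟ lookup v j) * (𝟙 (composition R u ≟ᶜ composition R (removeAt v j)) * stab R u))
    ≡⟨ Σ-cong (allFin _) matching ⟩
      Σ (allFin _) (λ j → 𝟙 (a ≟ lookup v j) * (same * stab R u))
    ≡⟨ Σ-*ʳ (allFin _) (same * stab R u) (λ j → 𝟙 (a ≟ lookup v j)) ⟩
      Σ (allFin _) (λ j → 𝟙 (a ≟ lookup v j)) * (same * stab R u)
    ≡⟨ cong (_* (same * stab R u)) occurrences ⟩
      count R a v * (same * stab R u)
    ≡⟨ first-letter (composition R (a ∷ u) ≟ᶜ composition R v) ⟩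
      same * stab R (a ∷ u) ∎
    where
    open ≡-Reasoning
    same = 𝟙 (composition R (a ∷ u) ≟ᶜ composition R v)

    matching : ∀ j → 𝟙 (a ≟ lookup v j) * (𝟙 (composition R u ≟ᶜ composition R (removeAt v j)) * stab R u)
                   ≡ 𝟙 (a ≟ lookup v j) * (same * stab R u)
    matching j with a ≟ lookup v j
    ... | no _  = refl
    ... | yes e = cong (λ t → 1 * (t * stab R u))
                       (𝟙-⇔ (composition-removeAt R a u v j (sym e))
                            (composition R u ≟ᶜ composition R (removeAt v j)) (composition R (a ∷ u) ≟ᶜ composition R v))

    occurrences : Σ (allFin _) (λ j → 𝟙 (a ≟ lookup v j)) ≡ count R a v
    occurrences = trans (Σ-cong (allFin _) (λ j → 𝟙-sym (a ≟ lookup v j) (lookup v j ≟ a)))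
                        (Σ-lookup v (λ x → 𝟙 (x ≟ a)))

    -- with equal compositions, a occurs in v once more than in u
    first-letter : (d : Dec (composition R (a ∷ u) ≡ composition R v)) →
                   count R a v * (𝟙 d * stab R u) ≡ 𝟙 d * stab R (a ∷ u)
    first-letter (no _)  = *-zeroʳ (count R a v)
    first-letter (yes c) = begin
        count R a v * (stab R u + 0)         ≡⟨ cong₂ _*_ (same-composition⇒same-counts R {u = a ∷ u} {v} c a) (sym (+-identityʳ (stab R u))) ⟨
        count R a (a ∷ u) * stab R u         ≡⟨ cong (λ k → (k + count R a u) * stab R u) (𝟙-yes (a ≟ a) refl) ⟩
        suc (count R a u) * stab R u         ≡⟨ stab-∷ R a u ⟨
        stab R (a ∷ u)                       ≡⟨ +-identityʳ (stab R (a ∷ u)) ⟨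
        stab R (a ∷ u) + 0                   ∎

-- Both sides of the theorem, times n!, count the same weighted pairs (u, v) ∈ C × D.
module _ (R : FinRing) {n : ℕ} where
  open FinRing R using (Carrier; card)

  private
    _≟ʷ_ : DecidableEquality (Vec Carrier n)
    _≟ʷ_ = ≡-dec (_≟R_ R)
    _≟ᶜ_ : DecidableEquality (Vec ℕ card)
    _≟ᶜ_ = ≡-dec ℕ._≟_
    words = allVecs R n

  A-as-sum : (C : LinearCode R n) (r : Vec ℕ card) →
             A R C r ≡ Σ words (λ u → 𝟙 (LinearCode.∈C? C u) * 𝟙 (composition R u ≟ᶜ r))
  A-as-sum C r = trans (length-filter _ words)
                       (Σ-cong words (λ u → 𝟙-× (LinearCode.∈C? C u) (composition R u ≟ᶜ r)))

  module _ (C D : LinearCode R n) where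
    private
      inC inD : Vec Carrier n → ℕ
      inC u = 𝟙 (LinearCode.∈C? C u)
      inD v = 𝟙 (LinearCode.∈C? D v)

    pairCount : ℕ
    pairCount = Σ words (λ u → Σ words (λ v → inC u * (inD v * (𝟙 (composition R u ≟ᶜ composition R v) * stab R u))))

    -- |C ∩ D^σ| = Σ_{u ∈ C} Σ_{v ∈ D} 𝟙(u = σ v), as σ v determines v.
    intersection-size : ∀ {σ} → σ ∈ perms n →
      ∣C∩D^σ∣ R C D σ ≡ Σ words (λ u → inC u * Σ words (λ v → inD v * 𝟙 (u ≟ʷ permute R σ v)))
    intersection-size {σ} σ∈ = trans (length-filter _ words) (Σ-cong words λ u →
      trans (𝟙-× (LinearCode.∈C? C u) (∈^? R D σ u)) (cong (inC u *_)
        (trans (𝟙-any _ words (allVecs-unique R n) (λ { (_ , e) (_ , e′) → permute-injective R σ∈ (trans (sym e) e′) }))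
               (Σ-cong words (λ v → 𝟙-× (LinearCode.∈C? D v) (u ≟ʷ permute R σ v))))))

    Σ-intersections : Σ (Sym R n) (∣C∩D^σ∣ R C D) ≡ pairCount
    Σ-intersections = begin
        Σ (Sym R n) (∣C∩D^σ∣ R C D)
      ≡⟨ Σ-Sym R n _ ⟩
        Σ (perms n) (∣C∩D^σ∣ R C D)
      ≡⟨ Σ-cong-∈ (perms n) intersection-size ⟩
        Σ (perms n) (λ σ → Σ words (λ u → inC u * Σ words (λ v → inD v * δ σ u v)))
      ≡⟨ Σ-cong (perms n) (λ σ → Σ-cong words (λ u → Σ-*ˡ words (inC u) _)) ⟨
        Σ (perms n) (λ σ → Σ words (λ u → Σ words (λ v → inC u * (inD v * δ σ u v))))
      ≡⟨ Σ-rotate (perms n) words words _ ⟩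
        Σ words (λ u → Σ words (λ v → Σ (perms n) (λ σ → inC u * (inD v * δ σ u v))))
      ≡⟨ Σ-cong words (λ u → Σ-cong words (λ v → pull-out u v)) ⟩
        pairCount ∎
      where
      open ≡-Reasoning
      δ = λ σ u v → 𝟙 (u ≟ʷ permute R σ v)
      pull-out : ∀ u v → Σ (perms n) (λ σ → inC u * (inD v * δ σ u v))
                       ≡ inC u * (inD v * (𝟙 (composition R u ≟ᶜ composition R v) * stab R u))
      pull-out u v = trans (Σ-*ˡ (perms n) (inC u) _) (cong (inC u *_)
                     (trans (Σ-*ˡ (perms n) (inD v) _) (cong (inD v *_) (transporters-formula R u v))))

    Σ-compositions : Σ (comps R card n) (λ r → A R C r * A R D r * factorials r) ≡ pairCount
    Σ-compositions = begin
        Σ (comps R card n) (λ r → A R C r * A R D r * factorials r)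
      ≡⟨ Σ-cong (comps R card n) (λ r → trans (cong₂ (λ x y → x * y * factorials r) (A-as-sum C r) (A-as-sum D r))
                                               (Σ-product words words _ _ (factorials r))) ⟩
        Σ (comps R card n) (λ r → Σ words (λ u → Σ words (λ v → (inC u * has u r) * ((inD v * has v r) * factorials r))))
      ≡⟨ Σ-rotate (comps R card n) words words _ ⟩
        Σ words (λ u → Σ words (λ v → Σ (comps R card n) (λ r → (inC u * has u r) * ((inD v * has v r) * factorials r))))
      ≡⟨ Σ-cong words (λ u → Σ-cong words (λ v → select u v)) ⟩
        pairCount ∎
      where
      open ≡-Reasoning
      has = λ u r → 𝟙 (composition R u ≟ᶜ r)
      regroup : ∀ a b c d e → (a * b) * ((c * d) * e) ≡ b * (a * (c * (d * e)))
      regroup = solve-∀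
      -- only r = composition u contributes
      select : ∀ u v → Σ (comps R card n) (λ r → (inC u * has u r) * ((inD v * has v r) * factorials r))
                     ≡ inC u * (inD v * (𝟙 (composition R u ≟ᶜ composition R v) * stab R u))
      select u v = begin
          Σ (comps R card n) (λ r → (inC u * has u r) * ((inD v * has v r) * factorials r))
        ≡⟨ Σ-cong (comps R card n) (λ r → regroup (inC u) _ (inD v) _ _) ⟩
          Σ (comps R card n) (λ r → has u r * (inC u * (inD v * (has v r * factorials r))))
        ≡⟨ Σ-δ _≟ᶜ_ (comps R card n) _ (comps-unique R card n) (composition∈comps R u) ⟩
          inC u * (inD v * (has v (composition R u) * stab R u))
        ≡⟨ cong (λ t → inC u * (inD v * (t * stab R u)))
                (𝟙-sym (composition R v ≟ᶜ composition R u) (composition R u ≟ᶜ composition R v)) ⟩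
          inC u * (inD v * (𝟙 (composition R u ≟ᶜ composition R v) * stab R u)) ∎

fromℚᵘ-≃ : ∀ (p : ℚ) (i : ℤ.ℤ) (d : ℕ) → toℚᵘ p ℚᵘ.≃ mkℚᵘ i d → p ≡ i / suc d
fromℚᵘ-≃ p i d eq = trans (sym (fromℚᵘ-toℚᵘ p)) (fromℚᵘ-cong eq)

integer*fraction : ∀ a b d .{{_ : NonZero d}} → (ℤ.+ a) / 1 ℚ.* ((ℤ.+ b) / d) ≡ (ℤ.+ (a * b)) / d
integer*fraction a b (suc d) = fromℚᵘ-≃ _ (ℤ.+ (a * b)) d
  (ℚᵘ.≃-trans (toℚᵘ-homo-* ((ℤ.+ a) / 1) ((ℤ.+ b) / suc d))
  (ℚᵘ.≃-trans (ℚᵘ.*-cong (toℚᵘ-fromℚᵘ (mkℚᵘ (ℤ.+ a) 0)) (toℚᵘ-fromℚᵘ (mkℚᵘ (ℤ.+ b) d)))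
     (*≡* (cong₂ ℤ._*_ (sym (ℤ.pos-* a b)) (cong (λ x → ℤ.+ suc x) (sym (+-identityʳ d)))))))

fraction+fraction : ∀ a b d .{{_ : NonZero d}} → (ℤ.+ a) / d ℚ.+ (ℤ.+ b) / d ≡ (ℤ.+ (a + b)) / d
fraction+fraction a b (suc d) = fromℚᵘ-≃ _ (ℤ.+ (a + b)) d
  (ℚᵘ.≃-trans (toℚᵘ-homo-+ ((ℤ.+ a) / suc d) ((ℤ.+ b) / suc d))
  (ℚᵘ.≃-trans (ℚᵘ.+-cong (toℚᵘ-fromℚᵘ (mkℚᵘ (ℤ.+ a) d)) (toℚᵘ-fromℚᵘ (mkℚᵘ (ℤ.+ b) d)))
     (*≡* (trans (cross-multiply (ℤ.+ a) (ℤ.+ b) (ℤ.+ suc d))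
                 (cong₂ ℤ._*_ (sym (ℤ.pos-+ a b)) (ℤ.pos-* (suc d) (suc d)))))))
  where
  cross-multiply : ∀ (x y s : ℤ.ℤ) → (x ℤ.* s ℤ.+ y ℤ.* s) ℤ.* s ≡ (x ℤ.+ y) ℤ.* (s ℤ.* s)
  cross-multiply = ℤ-Solver.solve-∀

sum-fractions : ∀ {a} {A : Set a} (xs : List A) (f : A → ℕ) d .{{_ : NonZero d}} →
                List.foldr ℚ._+_ 0ℚ (map (λ x → (ℤ.+ f x) / d) xs) ≡ (ℤ.+ Σ xs f) / d
sum-fractions []       f d = sym (0/n≡0 d)
sum-fractions (x ∷ xs) f d =
  trans (cong ((ℤ.+ f x) / d ℚ.+_) (sum-fractions xs f d)) (fraction+fraction (f x) (Σ xs f) d)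

-- The theorem.
proposition5p1 : (R : FinRing) → IsFiniteField R ⊎ IsZk R →
                 {n : ℕ} (C D : LinearCode R n) →
                 Δ R C D ≡ RHS R C D
proposition5p1 R _ {n} C D = begin
    Δ R C D
  ≡⟨⟩
    (ℤ.+ Σ (Sym R n) (∣C∩D^σ∣ R C D)) / n !
  ≡⟨ cong (λ k → (ℤ.+ k) / n !) (trans (Σ-intersections R C D) (sym (Σ-compositions R C D))) ⟩
    (ℤ.+ Σ (comps R card n) (λ r → A R C r * A R D r * factorials r)) / n !
  ≡⟨ sum-fractions (comps R card n) (λ r → A R C r * A R D r * factorials r) (n !) ⟨
    List.foldr ℚ._+_ 0ℚ (map (λ r → (ℤ.+ (A R C r * A R D r * factorials r)) / n !) (comps R card n))
  ≡⟨ cong (List.foldr ℚ._+_ 0ℚ) (map-cong (λ r → integer*fraction (A R C r * A R D r) (factorials r) (n !)) (comps R card n)) ⟨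
    RHS R C D ∎
  where
  open ≡-Reasoning
  open FinRing R using (card)
  instance _ = n !≢0
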